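{- There is a $g \in \operatorname{Perm}$ such that the problem $\mathrm{Conj}(g)$ is recursively unsolvable: there is no algorithm which, given a program for an arbitrary $f \in \operatorname{Perm}$ together with a decider for the cycle equivalence $\equiv_f$, correctly decides whether $f \sim g$.
   Context: $\mathcal{G}$ is the group of recursive permutations of $\mathbb{N}$; $x\equiv_f x'$ means $x' = f^k(x)$ for some $k\in\mathbb{Z}$. $\operatorname{Perm}$ is the set of $f\in\mathcal{G}$ for which $\equiv_f$ is decidable (a decider is a total recursive function computing the truth value of $x\equiv_f x'$). $f \sim g$ means there is $h\in\mathcal{G}$ with $f = h^{ -1}gh$. -}

module Defs where

open import Data.Nat using (ℕ; zero; suc; _+_; _<_)
open import Data.Fin using (Fin; toℕ)
open import Data.Vec using (Vec; []; _∷_)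
open import Data.Product using (Σ; _×_; _,_; ∃-syntax)
open import Data.Sum using (_⊎_)
open import Function using (Injective; Surjective)
open import Relation.Binary.PropositionalEquality using (_≡_)
open import Relation.Nullary using (¬_)

data Code : ℕ → Set where
  zeroᶜ : ∀ {n} → Code n
  succᶜ : Code 1
  proj  : ∀ {n} → Fin n → Code n
  comp  : ∀ {m n} → Code m → Vec (Code n) m → Code n
  prec  : ∀ {n} → Code n → Code (suc (suc n)) → Code (suc n)
  mu    : ∀ {n} → Code (suc n) → Code n

lookupV : ∀ {A : Set} {n} → Vec A n → Fin n → A
lookupV (x ∷ xs) Fin.zero    = x
lookupV (x ∷ xs) (Fin.suc i) = lookupV xs i

mutual
  data Eval : ∀ {n} → Code n → Vec ℕ n → ℕ → Set where
    ev-zero : ∀ {n} {xs : Vec ℕ n} → Eval zeroᶜ xs 0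
    ev-succ : ∀ {x} → Eval succᶜ (x ∷ []) (suc x)
    ev-proj : ∀ {n} {xs : Vec ℕ n} (i : Fin n) → Eval (proj i) xs (lookupV xs i)
    ev-comp : ∀ {m n} {c : Code m} {cs : Vec (Code n) m} {xs : Vec ℕ n} {ys : Vec ℕ m} {y} →
              EvalVec cs xs ys → Eval c ys y → Eval (comp c cs) xs y
    ev-prec-z : ∀ {n} {b : Code n} {s : Code (suc (suc n))} {xs : Vec ℕ n} {y} →
                Eval b xs y → Eval (prec b s) (0 ∷ xs) y
    ev-prec-s : ∀ {n} {b : Code n} {s : Code (suc (suc n))} {xs : Vec ℕ n} {k r y} →
                Eval (prec b s) (k ∷ xs) r → Eval s (r ∷ k ∷ xs) y →
                Eval (prec b s) (suc k ∷ xs) y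
    ev-mu : ∀ {n} {c : Code (suc n)} {xs : Vec ℕ n} {y} →
            Eval c (y ∷ xs) 0 →
            (∀ i → i < y → Σ ℕ λ k → Eval c (i ∷ xs) (suc k)) →
            Eval (mu c) xs y

  data EvalVec : ∀ {m n} → Vec (Code n) m → Vec ℕ n → Vec ℕ m → Set where
    evv-[] : ∀ {n} {xs : Vec ℕ n} → EvalVec [] xs []
    evv-∷  : ∀ {m n} {c : Code n} {cs : Vec (Code n) m} {xs : Vec ℕ n} {y ys} →
             Eval c xs y → EvalVec cs xs ys → EvalVec (c ∷ cs) xs (y ∷ ys)

triangle : ℕ → ℕ
triangle zero    = zero
triangle (suc n) = suc n + triangle n

pair : ℕ → ℕ → ℕ
pair x y = triangle (x + y) + y

mutual
  ⌜_⌝ : ∀ {n} → Code n → ℕ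
  ⌜ zeroᶜ {n} ⌝      = pair 0 n
  ⌜ succᶜ ⌝          = pair 1 0
  ⌜ proj i ⌝         = pair 2 (toℕ i)
  ⌜ comp {m} c cs ⌝  = pair 3 (pair m (pair ⌜ c ⌝ (⌜_⌝ᵛ cs)))
  ⌜ prec b s ⌝       = pair 4 (pair ⌜ b ⌝ ⌜ s ⌝)
  ⌜ mu c ⌝           = pair 5 ⌜ c ⌝

  ⌜_⌝ᵛ : ∀ {m n} → Vec (Code n) m → ℕ
  ⌜ [] ⌝ᵛ     = 0
  ⌜ c ∷ cs ⌝ᵛ = suc (pair ⌜ c ⌝ ⌜ cs ⌝ᵛ)

Computes : Code 1 → (ℕ → ℕ) → Set
Computes e f = ∀ x → Eval e (x ∷ []) (f x)

IsRecursive : (ℕ → ℕ) → Set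
IsRecursive f = Σ (Code 1) λ e → Computes e f

IsBijection : (ℕ → ℕ) → Set
IsBijection f = Injective _≡_ _≡_ f × Surjective _≡_ _≡_ f

In𝒢 : (ℕ → ℕ) → Set
In𝒢 f = IsBijection f × IsRecursive f

iter : (ℕ → ℕ) → ℕ → ℕ → ℕ
iter f zero    x = x
iter f (suc n) x = f (iter f n x)

-- x ≡_f x' : x' = f^k x for some k ∈ ℤ
-- (k = n ≥ 0: f^n x = x';  k = -n ≤ 0: x' = f^{-n} x, i.e. f^n x' = x)
CycleEq : (ℕ → ℕ) → ℕ → ℕ → Set
CycleEq f x x' = ∃[ n ] (iter f n x ≡ x' ⊎ iter f n x' ≡ x)

DecidesRel : Code 2 → (ℕ → ℕ → Set) → Set
DecidesRel d R = ∀ x y → Σ ℕ λ b → Eval d (x ∷ y ∷ []) b ×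
                   ((R x y × b ≡ 1) ⊎ (¬ R x y × b ≡ 0))

InPerm : (ℕ → ℕ) → Set
InPerm f = In𝒢 f × Σ (Code 2) λ d → DecidesRel d (CycleEq f)

-- f ∼ g : f = h⁻¹ g h for some h ∈ 𝒢  (equivalently h ∘ f = g ∘ h)
_∼_ : (ℕ → ℕ) → (ℕ → ℕ) → Set
f ∼ g = Σ (ℕ → ℕ) λ h → In𝒢 h × (∀ x → h (f x) ≡ g (h x))

SolvesConj : (ℕ → ℕ) → Code 2 → Set
SolvesConj g a =
  ∀ (f : ℕ → ℕ) (e : Code 1) (d : Code 2) →
  IsBijection f → Computes e f → DecidesRel d (CycleEq f) →
  Σ ℕ λ b → Eval a (⌜ e ⌝ ∷ ⌜ d ⌝ ∷ []) b × ((f ∼ g × b ≡ 1) ⊎ (¬ (f ∼ g) × b ≡ 0))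

module Submission where

-- Take g = id.  Given a program a that claims to solve Conj(id), build, by explicit
-- self-reference, a program e for a permutation f and a decider d for ≡_f such that f swaps
-- 2t and 2t + 1 exactly when a, run with fuel t on (⌜ e ⌝ , ⌜ d ⌝), has answered 1.
-- Such an f is an involution, hence bijective with decidable cycle equivalence.  If a
-- answers 1 then f moves a point, so f ≁ id, because the only conjugate of id is id; if a
-- answers 0 it never answers 1, so f = id ∼ id.  Either way a answers wrongly.  Self-reference
-- needs no recursion theorem here: codes of numerals are primitive recursive in the numeral,
-- and bounded evaluation of the fixed program a is primitive recursive.

open import Defs
open import Data.Product using (Σ; _×_; _,_; proj₁; proj₂)
open import Data.Nat using (ℕ; zero; suc; _+_; _∸_; _≤_; _<_; _⊔_; pred; s≤s⁻¹)
open import Data.Nat.Properties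
open import Data.Fin using (Fin; _↑ʳ_) renaming (zero to fz; suc to fs)
open import Data.Vec using (Vec; []; _∷_; _++_; map; head; tail)
open import Data.Sum using (_⊎_; inj₁; inj₂; [_,_])
open import Data.Empty using (⊥-elim)
open import Function using (id)
open import Relation.Nullary using (¬_; yes; no)
open import Relation.Binary.PropositionalEquality hiding ([_])
open import Algebra.Definitions {A = ℕ} _≡_ using (Involutive)

record Prog (n : ℕ) : Set where
  constructor prog
  field
    code : Code n
    fun  : Vec ℕ n → ℕ
    sem  : ∀ xs → Eval code xs (fun xs)
open Prog

funs : ∀ {n m} → Vec (Prog n) m → Vec ℕ n → Vec ℕ m
funs []       xs = []
funs (p ∷ ps) xs = fun p xs ∷ funs ps xs

codes : ∀ {n m} → Vec (Prog n) m → Vec (Code n) m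
codes []       = []
codes (p ∷ ps) = code p ∷ codes ps

sems : ∀ {n m} (ps : Vec (Prog n) m) xs → EvalVec (codes ps) xs (funs ps xs)
sems []       xs = evv-[]
sems (p ∷ ps) xs = evv-∷ (sem p xs) (sems ps xs)

compose : ∀ {n m} → Prog m → Vec (Prog n) m → Prog n
compose p ps = prog (comp (code p) (codes ps)) (λ xs → fun p (funs ps xs))
                    (λ xs → ev-comp (sems ps xs) (sem p (funs ps xs)))

projP : ∀ {n} → Fin n → Prog n
projP i = prog (proj i) (λ xs → lookupV xs i) (λ xs → ev-proj i)

natrec : ∀ {n} → (Vec ℕ n → ℕ) → (Vec ℕ (suc (suc n)) → ℕ) → ℕ → Vec ℕ n → ℕ
natrec b s zero    xs = b xs
natrec b s (suc k) xs = s (natrec b s k xs ∷ k ∷ xs)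

primRec : ∀ {n} → Prog n → Prog (suc (suc n)) → Prog (suc n)
primRec {n} b s = prog (prec (code b) (code s)) (λ xs → natrec (fun b) (fun s) (head xs) (tail xs)) evaluates
  where
  evaluates : ∀ xs → Eval (prec (code b) (code s)) xs (natrec (fun b) (fun s) (head xs) (tail xs))
  evaluates (zero  ∷ xs) = ev-prec-z (sem b xs)
  evaluates (suc k ∷ xs) = ev-prec-s (evaluates (k ∷ xs)) (sem s _)

withFun : ∀ {n} (p : Prog n) (g : Vec ℕ n → ℕ) → (∀ xs → fun p xs ≡ g xs) → Prog n
withFun p g eq = prog (code p) g (λ xs → subst (Eval (code p) xs) (eq xs) (sem p xs))

numeral : ∀ {n} → ℕ → Code n
numeral zero    = zeroᶜ
numeral (suc k) = comp succᶜ (numeral k ∷ [])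

numeral-sem : ∀ {n} k (xs : Vec ℕ n) → Eval (numeral k) xs k
numeral-sem zero    xs = ev-zero
numeral-sem (suc k) xs = ev-comp (evv-∷ (numeral-sem k xs) evv-[]) ev-succ

const : ∀ {n} → ℕ → Prog n
const k = prog (numeral k) (λ _ → k) (numeral-sem k)

π₀ : ∀ {n} → Prog (suc n)
π₀ = projP fz
π₁ : ∀ {n} → Prog (suc (suc n))
π₁ = projP (fs fz)
π₂ : ∀ {n} → Prog (suc (suc (suc n)))
π₂ = projP (fs (fs fz))
π₃ : ∀ {n} → Prog (suc (suc (suc (suc n))))
π₃ = projP (fs (fs (fs fz)))

projs : ∀ {N} m → (Fin m → Fin N) → Vec (Prog N) m
projs zero    σ = []
projs (suc m) σ = projP (σ fz) ∷ projs m (λ i → σ (fs i))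

funs-projs : ∀ {N m} (σ : Fin m → Fin N) (zs : Vec ℕ N) (xs : Vec ℕ m) →
             (∀ i → lookupV zs (σ i) ≡ lookupV xs i) → funs (projs m σ) zs ≡ xs
funs-projs σ zs []       h = refl
funs-projs σ zs (x ∷ xs) h = cong₂ _∷_ (h fz) (funs-projs (λ i → σ (fs i)) zs xs (λ i → h (fs i)))

dropProjs : ∀ k {n} → Vec (Prog (k + n)) n
dropProjs k {n} = projs n (k ↑ʳ_)

lookupV-↑ʳ : ∀ {k n} (ys : Vec ℕ k) (xs : Vec ℕ n) i → lookupV (ys ++ xs) (k ↑ʳ i) ≡ lookupV xs i
lookupV-↑ʳ []       xs i = refl
lookupV-↑ʳ (y ∷ ys) xs i = lookupV-↑ʳ ys xs i

funs-dropProjs : ∀ k {n} (ys : Vec ℕ k) (xs : Vec ℕ n) → funs (dropProjs k) (ys ++ xs) ≡ xs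
funs-dropProjs k ys xs = funs-projs (k ↑ʳ_) (ys ++ xs) xs (lookupV-↑ʳ ys xs)

ifz : ℕ → ℕ → ℕ → ℕ
ifz zero    a b = a
ifz (suc r) a b = b

eqb : ℕ → ℕ → ℕ
eqb x y = ifz ((x ∸ y) + (y ∸ x)) 1 0

orb : ℕ → ℕ → ℕ
orb u v = ifz u v 1

eqb-refl : ∀ x → eqb x x ≡ 1
eqb-refl x rewrite n∸n≡0 x = refl

eqb-≢ : ∀ x y → x ≢ y → eqb x y ≡ 0
eqb-≢ x y x≢y with (x ∸ y) + (y ∸ x) in eq
... | suc _ = refl
... | zero  = ⊥-elim (x≢y (≤-antisym (m∸n≡0⇒m≤n (m+n≡0⇒m≡0 _ eq)) (m∸n≡0⇒m≤n (m+n≡0⇒n≡0 (x ∸ y) eq))))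

app₁ : ∀ {n} → Prog 1 → Prog n → Prog n
app₁ p a = compose p (a ∷ [])

app₂ : ∀ {n} → Prog 2 → Prog n → Prog n → Prog n
app₂ p a b = compose p (a ∷ b ∷ [])

SUCC : ∀ {n} → Prog n → Prog n
SUCC = app₁ (prog succᶜ (λ { (x ∷ []) → suc x }) (λ { (x ∷ []) → ev-succ }))

PRED : ∀ {n} → Prog n → Prog n
PRED = app₁ (withFun (primRec (const 0) π₁) (λ { (x ∷ []) → pred x })
                     (λ { (zero ∷ []) → refl ; (suc x ∷ []) → refl }))

IFZ : ∀ {n} → Prog n → Prog n → Prog n → Prog n
IFZ r a b = compose (withFun (primRec π₀ π₃) (λ { (r ∷ a ∷ b ∷ []) → ifz r a b })
                             (λ { (zero ∷ a ∷ b ∷ []) → refl ; (suc r ∷ a ∷ b ∷ []) → refl }))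
                    (r ∷ a ∷ b ∷ [])

ADD : ∀ {n} → Prog n → Prog n → Prog n
ADD = app₂ (withFun addition (λ { (x ∷ y ∷ []) → x + y }) (λ { (x ∷ y ∷ []) → computes x y }))
  where
  addition : Prog 2
  addition = primRec π₀ (SUCC π₀)
  computes : ∀ x y → fun addition (x ∷ y ∷ []) ≡ x + y
  computes zero    y = refl
  computes (suc x) y = cong suc (computes x y)

SUB : ∀ {n} → Prog n → Prog n → Prog n
SUB = app₂ (withFun (app₂ subtraction π₁ π₀) (λ { (x ∷ y ∷ []) → x ∸ y })
                    (λ { (x ∷ y ∷ []) → computes y x }))
  where
  subtraction : Prog 2
  subtraction = primRec π₀ (PRED π₀)
  computes : ∀ y x → fun subtraction (y ∷ x ∷ []) ≡ x ∸ y
  computes zero    x = refl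
  computes (suc y) x = trans (cong pred (computes y x)) (pred[m∸n]≡m∸[1+n] x y)

EQ : ∀ {n} → Prog n → Prog n → Prog n
EQ a b = IFZ (ADD (SUB a b) (SUB b a)) (const 1) (const 0)

OR : ∀ {n} → Prog n → Prog n → Prog n
OR u v = IFZ u v (const 1)

PAIR : ∀ {n} → Prog n → Prog n → Prog n
PAIR a b = ADD (TRIANGLE (ADD a b)) b
  where
  triangleP : Prog 1
  triangleP = primRec (const 0) (ADD (SUCC π₁) π₀)
  computes : ∀ k → fun triangleP (k ∷ []) ≡ triangle k
  computes zero    = refl
  computes (suc k) = cong (suc k +_) (computes k)
  TRIANGLE : ∀ {n} → Prog n → Prog n
  TRIANGLE = app₁ (withFun triangleP (λ { (k ∷ []) → triangle k }) (λ { (k ∷ []) → computes k }))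

-- Fuel-bounded evaluation: run t c xs is 0 while undecided and suc y once c returns y.

guard : ∀ {m} → Vec ℕ m → ℕ → ℕ
guard []       v = v
guard (r ∷ rs) v = ifz r 0 (guard rs v)

-- state of the search for μ: 0 while every earlier value was nonzero,
-- 1 when some earlier value was not available, suc (suc i) once i was found
searchStep : ℕ → ℕ → ℕ → ℕ
searchStep r i v = ifz r (ifz v 1 (ifz (pred v) (suc (suc i)) 0)) r

mutual
  run : ∀ {n} → ℕ → Code n → Vec ℕ n → ℕ
  run t zeroᶜ       xs       = 1
  run t succᶜ       (x ∷ []) = suc (suc x)
  run t (proj i)    xs       = suc (lookupV xs i)
  run t (comp c cs) xs       = guard (runs t cs xs) (run t c (map pred (runs t cs xs)))
  run t (prec b s)  (k ∷ xs) = runPrec t b s k xs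
  run t (mu c)      xs       = pred (search t c xs t)

  runs : ∀ {n m} → ℕ → Vec (Code n) m → Vec ℕ n → Vec ℕ m
  runs t []       xs = []
  runs t (c ∷ cs) xs = run t c xs ∷ runs t cs xs

  runPrec : ∀ {n} → ℕ → Code n → Code (suc (suc n)) → ℕ → Vec ℕ n → ℕ
  runPrec t b s zero    xs = run t b xs
  runPrec t b s (suc k) xs = ifz (runPrec t b s k xs) 0 (run t s (pred (runPrec t b s k xs) ∷ k ∷ xs))

  search : ∀ {n} → ℕ → Code (suc n) → Vec ℕ n → ℕ → ℕ
  search t c xs zero    = 0
  search t c xs (suc i) = searchStep (search t c xs i) i (run t c (i ∷ xs))

GUARD : ∀ {n m} → Vec (Prog n) m → Prog n → Prog n
GUARD []       q = q
GUARD (p ∷ ps) q = IFZ p (const 0) (GUARD ps q)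

GUARD-fun : ∀ {n m} (ps : Vec (Prog n) m) q xs → fun (GUARD ps q) xs ≡ guard (funs ps xs) (fun q xs)
GUARD-fun []       q xs = refl
GUARD-fun (p ∷ ps) q xs = cong (ifz (fun p xs) 0) (GUARD-fun ps q xs)

PREDS : ∀ {n m} → Vec (Prog n) m → Vec (Prog n) m
PREDS []       = []
PREDS (p ∷ ps) = PRED p ∷ PREDS ps

PREDS-fun : ∀ {n m} (ps : Vec (Prog n) m) xs → funs (PREDS ps) xs ≡ map pred (funs ps xs)
PREDS-fun []       xs = refl
PREDS-fun (p ∷ ps) xs = cong (pred (fun p xs) ∷_) (PREDS-fun ps xs)

SEARCHSTEP : ∀ {n} → Prog n → Prog n → Prog n → Prog n
SEARCHSTEP r i v = IFZ r (IFZ v (const 1) (IFZ (PRED v) (SUCC (SUCC i)) (const 0))) r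

mutual
  RUN : ∀ {n} → Code n → Prog (suc n)
  RUN c = withFun (RUN′ c) (λ xs → run (head xs) c (tail xs)) (RUN′-fun c)

  RUNS : ∀ {n m} → Vec (Code n) m → Vec (Prog (suc n)) m
  RUNS []       = []
  RUNS (c ∷ cs) = RUN c ∷ RUNS cs

  RUNS-fun : ∀ {n m} (cs : Vec (Code n) m) t xs → funs (RUNS cs) (t ∷ xs) ≡ runs t cs xs
  RUNS-fun []       t xs = refl
  RUNS-fun (c ∷ cs) t xs = cong (run t c xs ∷_) (RUNS-fun cs t xs)

  -- the step functions receive (previous value, counter, fuel, arguments)
  PRECSTEP : ∀ {n} → Code (suc (suc n)) → Prog (suc (suc (suc n)))
  PRECSTEP s = IFZ π₀ (const 0) (compose (RUN s) (π₂ ∷ PRED π₀ ∷ π₁ ∷ dropProjs 3))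

  MUSTEP : ∀ {n} → Code (suc n) → Prog (suc (suc (suc n)))
  MUSTEP c = SEARCHSTEP π₀ π₁ (compose (RUN c) (π₂ ∷ π₁ ∷ dropProjs 3))

  RUN′ : ∀ {n} → Code n → Prog (suc n)
  RUN′ zeroᶜ       = const 1
  RUN′ succᶜ       = SUCC (SUCC π₁)
  RUN′ (proj i)    = SUCC (projP (fs i))
  RUN′ (comp c cs) = GUARD (RUNS cs) (compose (RUN c) (π₀ ∷ PREDS (RUNS cs)))
  RUN′ (prec b s)  = compose (primRec (RUN b) (PRECSTEP s)) (π₁ ∷ π₀ ∷ dropProjs 2)
  RUN′ (mu c)      = PRED (compose (primRec (const 0) (MUSTEP c)) (π₀ ∷ π₀ ∷ dropProjs 1))

  natrec-PRECSTEP : ∀ {n} (b : Code n) s t k ys →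
    natrec (fun (RUN b)) (fun (PRECSTEP s)) k (t ∷ ys) ≡ runPrec t b s k ys
  natrec-PRECSTEP b s t zero    ys = refl
  natrec-PRECSTEP b s t (suc k) ys
    rewrite funs-dropProjs 3 (natrec (fun (RUN b)) (fun (PRECSTEP s)) k (t ∷ ys) ∷ k ∷ t ∷ []) ys
          | natrec-PRECSTEP b s t k ys = refl

  natrec-MUSTEP : ∀ {n} (c : Code (suc n)) t i ys →
    natrec (λ _ → 0) (fun (MUSTEP c)) i (t ∷ ys) ≡ search t c ys i
  natrec-MUSTEP c t zero    ys = refl
  natrec-MUSTEP c t (suc i) ys
    rewrite funs-dropProjs 3 (natrec (λ _ → 0) (fun (MUSTEP c)) i (t ∷ ys) ∷ i ∷ t ∷ []) ys
          | natrec-MUSTEP c t i ys = refl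

  RUN′-fun : ∀ {n} (c : Code n) xs → fun (RUN′ c) xs ≡ run (head xs) c (tail xs)
  RUN′-fun zeroᶜ       (t ∷ xs)     = refl
  RUN′-fun succᶜ       (t ∷ x ∷ []) = refl
  RUN′-fun (proj i)    (t ∷ xs)     = refl
  RUN′-fun (comp c cs) (t ∷ xs)     =
    trans (GUARD-fun (RUNS cs) _ (t ∷ xs))
          (cong₂ guard (RUNS-fun cs t xs)
                 (cong (run t c) (trans (PREDS-fun (RUNS cs) (t ∷ xs)) (cong (map pred) (RUNS-fun cs t xs)))))
  RUN′-fun (prec b s)  (t ∷ k ∷ ys) =
    trans (cong (λ zs → natrec (fun (RUN b)) (fun (PRECSTEP s)) k (t ∷ zs)) (funs-dropProjs 2 (t ∷ k ∷ []) ys))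
          (natrec-PRECSTEP b s t k ys)
  RUN′-fun (mu c)      (t ∷ ys)     =
    cong pred (trans (cong (λ zs → natrec (λ _ → 0) (fun (MUSTEP c)) t (t ∷ zs)) (funs-dropProjs 1 (t ∷ []) ys))
                     (natrec-MUSTEP c t t ys))

guard-inv : ∀ {m} (rs : Vec ℕ m) v y → guard rs v ≡ suc y → Σ (Vec ℕ m) λ ys → rs ≡ map suc ys × v ≡ suc y
guard-inv []           v y eq = [] , refl , eq
guard-inv (suc r ∷ rs) v y eq with guard-inv rs v y eq
... | ys , rs≡ , v≡ = r ∷ ys , cong (suc r ∷_) rs≡ , v≡

guard-map-suc : ∀ {m} (ys : Vec ℕ m) v → guard (map suc ys) v ≡ v
guard-map-suc []       v = refl
guard-map-suc (y ∷ ys) v = guard-map-suc ys v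

map-pred-suc : ∀ {m} (ys : Vec ℕ m) → map pred (map suc ys) ≡ ys
map-pred-suc []       = refl
map-pred-suc (y ∷ ys) = cong (y ∷_) (map-pred-suc ys)

Positive : ∀ {n} → ℕ → Code (suc n) → Vec ℕ n → ℕ → Set
Positive t c xs j = Σ ℕ λ k → run t c (j ∷ xs) ≡ suc (suc k)

search-0 : ∀ {n} t (c : Code (suc n)) xs i → search t c xs i ≡ 0 → ∀ j → j < i → Positive t c xs j
search-0 t c xs (suc i) eq j j<i with search t c xs i in e | run t c (i ∷ xs) in r
... | zero | suc (suc k) with m≤n⇒m<n∨m≡n (s≤s⁻¹ j<i)
...   | inj₁ j<i′ = search-0 t c xs i e j j<i′
...   | inj₂ refl = k , r

search-found : ∀ {n} t (c : Code (suc n)) xs i y → search t c xs i ≡ suc (suc y) →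
               run t c (y ∷ xs) ≡ 1 × (∀ j → j < y → Positive t c xs j)
search-found t c xs (suc i) y eq with search t c xs i in e | run t c (i ∷ xs) in r
search-found t c xs (suc i) .i refl | zero  | suc zero = r , search-0 t c xs i e
search-found t c xs (suc i) y  refl | suc _ | _        = search-found t c xs i y e

mutual
  run-sound : ∀ {n} t (c : Code n) xs y → run t c xs ≡ suc y → Eval c xs y
  run-sound t zeroᶜ       xs       .0               refl = ev-zero
  run-sound t succᶜ       (x ∷ []) .(suc x)         refl = ev-succ
  run-sound t (proj i)    xs       .(lookupV xs i)  refl = ev-proj i
  run-sound t (comp c cs) xs       y eq with guard-inv (runs t cs xs) _ y eq
  ... | ys , runs≡ , run≡ =
    ev-comp (runs-sound t cs xs ys runs≡)
            (run-sound t c ys y (trans (cong (run t c) (sym (trans (cong (map pred) runs≡) (map-pred-suc ys)))) run≡))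
  run-sound t (prec b s)  (k ∷ xs) y eq = runPrec-sound t b s k xs y eq
  run-sound t (mu c)      xs       y eq with search t c xs t in e
  run-sound t (mu c) xs .y′ refl | suc (suc y′) with search-found t c xs t y′ e
  ... | zero-at-y′ , positive-below =
    ev-mu (run-sound t c (y′ ∷ xs) 0 zero-at-y′)
          (λ j j<y → proj₁ (positive-below j j<y) , run-sound t c (j ∷ xs) _ (proj₂ (positive-below j j<y)))

  runs-sound : ∀ {n m} t (cs : Vec (Code n) m) xs ys → runs t cs xs ≡ map suc ys → EvalVec cs xs ys
  runs-sound t []       xs []       eq = evv-[]
  runs-sound t (c ∷ cs) xs (y ∷ ys) eq =
    evv-∷ (run-sound t c xs y (cong head eq)) (runs-sound t cs xs ys (cong tail eq))

  runPrec-sound : ∀ {n} t (b : Code n) s k xs y → runPrec t b s k xs ≡ suc y → Eval (prec b s) (k ∷ xs) y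
  runPrec-sound t b s zero    xs y eq = ev-prec-z (run-sound t b xs y eq)
  runPrec-sound t b s (suc k) xs y eq with runPrec t b s k xs in e
  ... | suc r = ev-prec-s (runPrec-sound t b s k xs r e) (run-sound t s (r ∷ k ∷ xs) y eq)

Eventually : (ℕ → Set) → Set
Eventually P = Σ ℕ λ t₀ → ∀ t → t₀ ≤ t → P t

eventually-∧ : ∀ {P Q : ℕ → Set} → Eventually P → Eventually Q → Eventually (λ t → P t × Q t)
eventually-∧ (t₁ , p) (t₂ , q) = t₁ ⊔ t₂ , λ t le → p t (≤-trans (m≤m⊔n t₁ t₂) le) , q t (≤-trans (m≤n⊔m t₁ t₂) le)

eventually-at : ∀ {P : ℕ → Set} → Eventually P → Σ ℕ P
eventually-at (t₀ , p) = t₀ , p t₀ ≤-refl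

eventually-below : ∀ {n} (c : Code (suc n)) xs y →
  (∀ j → j < y → Σ ℕ λ k → Eventually λ t → run t c (j ∷ xs) ≡ suc (suc k)) →
  ∀ m → m ≤ y → Eventually λ t → ∀ j → j < m → Positive t c xs j
eventually-below c xs y pos zero    m≤y = 0 , λ t _ j ()
eventually-below c xs y pos (suc m) m<y
  with eventually-∧ (eventually-below c xs y pos m (≤-trans (n≤1+n m) m<y)) (proj₂ (pos m m<y))
... | t₀ , below = t₀ , λ t t₀≤t j j<m → extend t t₀≤t j (m≤n⇒m<n∨m≡n (s≤s⁻¹ j<m))
  where
  extend : ∀ t → t₀ ≤ t → ∀ j → j < m ⊎ j ≡ m → Positive t c xs j
  extend t t₀≤t j (inj₁ j<m) = proj₁ (below t t₀≤t) j j<m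
  extend t t₀≤t j (inj₂ refl) = proj₁ (pos m m<y) , proj₂ (below t t₀≤t)

search-before : ∀ {n} t (c : Code (suc n)) xs y → (∀ j → j < y → Positive t c xs j) →
                ∀ i → i ≤ y → search t c xs i ≡ 0
search-before t c xs y pos zero    _   = refl
search-before t c xs y pos (suc i) i<y with pos i i<y
... | k , e rewrite search-before t c xs y pos i (≤-trans (n≤1+n i) i<y) | e = refl

search-stays : ∀ {n} t (c : Code (suc n)) xs y → (∀ j → j < y → Positive t c xs j) →
               run t c (y ∷ xs) ≡ 1 → ∀ d → search t c xs (d + suc y) ≡ suc (suc y)
search-stays t c xs y pos e zero    rewrite search-before t c xs y pos y ≤-refl | e = refl
search-stays t c xs y pos e (suc d) rewrite search-stays t c xs y pos e d = refl

mutual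
  run-complete : ∀ {n} {c : Code n} {xs y} → Eval c xs y → Eventually λ t → run t c xs ≡ suc y
  run-complete ev-zero     = 0 , λ _ _ → refl
  run-complete ev-succ     = 0 , λ _ _ → refl
  run-complete (ev-proj i) = 0 , λ _ _ → refl
  run-complete (ev-comp {c = c} {cs} {xs} {ys} {y} evs ev)
    with eventually-∧ (runs-complete evs) (run-complete ev)
  ... | t₀ , both = t₀ , λ t le →
    let runs≡ , run≡ = both t le in
    begin
      guard (runs t cs xs) (run t c (map pred (runs t cs xs)))
        ≡⟨ cong (λ zs → guard zs (run t c (map pred zs))) runs≡ ⟩
      guard (map suc ys) (run t c (map pred (map suc ys)))
        ≡⟨ guard-map-suc ys _ ⟩
      run t c (map pred (map suc ys))
        ≡⟨ cong (run t c) (map-pred-suc ys) ⟩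
      run t c ys
        ≡⟨ run≡ ⟩
      suc y ∎
    where open ≡-Reasoning
  run-complete (ev-prec-z ev) = run-complete ev
  run-complete (ev-prec-s {s = s} {xs} {k} ev₁ ev₂) with eventually-∧ (run-complete ev₁) (run-complete ev₂)
  ... | t₀ , both = t₀ , λ t le →
    trans (cong (λ z → ifz z 0 (run t s (pred z ∷ k ∷ xs))) (proj₁ (both t le))) (proj₂ (both t le))
  run-complete (ev-mu {c = c} {xs} {y} ev pos)
    with eventually-∧ (eventually-∧ (suc y , λ _ le → le) (run-complete ev))
                      (eventually-below c xs y (λ j j<y → proj₁ (pos j j<y) , run-complete (proj₂ (pos j j<y))) y ≤-refl)
  ... | t₀ , all = t₀ , λ t le →
    let (y<t , zero-at-y) , positive-below = all t le in
    cong pred (trans (cong (search t c xs) (sym (m∸n+n≡m y<t)))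
                     (search-stays t c xs y positive-below zero-at-y (t ∸ suc y)))

  runs-complete : ∀ {n m} {cs : Vec (Code n) m} {xs ys} → EvalVec cs xs ys →
                  Eventually λ t → runs t cs xs ≡ map suc ys
  runs-complete evv-[] = 0 , λ _ _ → refl
  runs-complete (evv-∷ ev evs) with eventually-∧ (run-complete ev) (runs-complete evs)
  ... | t₀ , both = t₀ , λ t le → cong₂ _∷_ (proj₁ (both t le)) (proj₂ (both t le))

Eval-deterministic : ∀ {n} {c : Code n} {xs y y′} → Eval c xs y → Eval c xs y′ → y ≡ y′
Eval-deterministic ev ev′ with eventually-at (eventually-∧ (run-complete ev) (run-complete ev′))
... | t , run≡y , run≡y′ = suc-injective (trans (sym run≡y) run≡y′)

parity : ℕ → ℕ
parity zero    = 0
parity (suc k) = 1 ∸ parity k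

half : ℕ → ℕ
half zero    = 0
half (suc k) = half k + parity k

xor1 : ℕ → ℕ
xor1 x = ifz (parity x) (suc x) (pred x)

swapWhen : (ℕ → ℕ) → ℕ → ℕ
swapWhen h x = ifz (h (half x)) x (xor1 x)

PARITY : ∀ {n} → Prog n → Prog n
PARITY = app₁ (withFun parityP (λ { (k ∷ []) → parity k }) (λ { (k ∷ []) → computes k }))
  where
  parityP : Prog 1
  parityP = primRec (const 0) (SUB (const 1) π₀)
  computes : ∀ k → fun parityP (k ∷ []) ≡ parity k
  computes zero    = refl
  computes (suc k) = cong (1 ∸_) (computes k)

HALF : ∀ {n} → Prog n → Prog n
HALF = app₁ (withFun halfP (λ { (k ∷ []) → half k }) (λ { (k ∷ []) → computes k }))
  where
  halfP : Prog 1
  halfP = primRec (const 0) (ADD π₀ (PARITY π₁))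
  computes : ∀ k → fun halfP (k ∷ []) ≡ half k
  computes zero    = refl
  computes (suc k) = cong (_+ parity k) (computes k)

XOR1 : ∀ {n} → Prog n → Prog n
XOR1 x = IFZ (PARITY x) (SUCC x) (PRED x)

parity-bit : ∀ k → parity k ≡ 0 ⊎ parity k ≡ 1
parity-bit zero = inj₁ refl
parity-bit (suc k) with parity-bit k
... | inj₁ e rewrite e = inj₂ refl
... | inj₂ e rewrite e = inj₁ refl

parity-+2 : ∀ k → parity (suc (suc k)) ≡ parity k
parity-+2 k with parity-bit k
... | inj₁ e rewrite e = refl
... | inj₂ e rewrite e = refl

half-+2 : ∀ k → half (suc (suc k)) ≡ suc (half k)
half-+2 k with parity-bit k
... | inj₁ e rewrite e = trans (+-comm (half k + 0) 1) (cong suc (+-identityʳ (half k)))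
... | inj₂ e rewrite e = trans (+-assoc (half k) 1 0) (+-comm (half k) 1)

half-double : ∀ t → half (t + t) ≡ t
half-double zero    = refl
half-double (suc t) rewrite +-suc t t | half-+2 (t + t) = cong suc (half-double t)

xor1-+2 : ∀ k → xor1 (suc (suc k)) ≡ suc (suc (xor1 k))
xor1-+2 zero = refl
xor1-+2 (suc k) with parity-bit (suc k)
... | inj₁ e rewrite parity-+2 (suc k) | e = refl
... | inj₂ e rewrite parity-+2 (suc k) | e = refl

xor1-involutive : Involutive xor1
xor1-involutive zero          = refl
xor1-involutive (suc zero)    = refl
xor1-involutive (suc (suc k)) rewrite xor1-+2 k | xor1-+2 (xor1 k) = cong (λ z → suc (suc z)) (xor1-involutive k)

half-xor1 : ∀ x → half (xor1 x) ≡ half x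
half-xor1 zero          = refl
half-xor1 (suc zero)    = refl
half-xor1 (suc (suc k)) rewrite xor1-+2 k | half-+2 (xor1 k) | half-+2 k = cong suc (half-xor1 k)

xor1-≢ : ∀ x → xor1 x ≢ x
xor1-≢ (suc (suc k)) eq rewrite xor1-+2 k = xor1-≢ k (suc-injective (suc-injective eq))

swapWhen-involutive : ∀ h → Involutive (swapWhen h)
swapWhen-involutive h x with h (half x) in eq
... | zero  rewrite eq = refl
... | suc _ rewrite half-xor1 x | eq = xor1-involutive x

swapWhen-moves : ∀ h t {k} → h t ≡ suc k → swapWhen h (t + t) ≢ t + t
swapWhen-moves h t eq rewrite half-double t | eq = xor1-≢ (t + t)

swapWhen-id : ∀ h → (∀ t → h t ≡ 0) → ∀ x → swapWhen h x ≡ x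
swapWhen-id h h≡0 x rewrite h≡0 (half x) = refl

involutive⇒bijective : ∀ {f} → Involutive f → IsBijection f
involutive⇒bijective {f} inv = (λ {x} {y} eq → trans (sym (inv x)) (trans (cong f eq) (inv y)))
                             , (λ y → f y , λ {z} z≡ → trans (cong f z≡) (inv y))

iter-involutive : ∀ {f} → Involutive f → ∀ n x → iter f n x ≡ x ⊎ iter f n x ≡ f x
iter-involutive inv zero    x = inj₁ refl
iter-involutive {f} inv (suc n) x with iter-involutive inv n x
... | inj₁ eq = inj₂ (cong f eq)
... | inj₂ eq = inj₁ (trans (cong f eq) (inv x))

cycleEq-involutive : ∀ {f} → Involutive f → ∀ {x y} → CycleEq f x y → y ≡ x ⊎ y ≡ f x
cycleEq-involutive inv {x} (n , inj₁ eq) with iter-involutive inv n x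
... | inj₁ e = inj₁ (trans (sym eq) e)
... | inj₂ e = inj₂ (trans (sym eq) e)
cycleEq-involutive {f} inv {y = y} (n , inj₂ eq) with iter-involutive inv n y
... | inj₁ e = inj₁ (trans (sym e) eq)
... | inj₂ e = inj₂ (trans (sym (inv y)) (cong f (trans (sym e) eq)))

Verdict : Set → ℕ → Set
Verdict P b = (P × b ≡ 1) ⊎ (¬ P × b ≡ 0)

involutive-cycleEq-verdict : ∀ {f} → Involutive f → ∀ x y → Verdict (CycleEq f x y) (orb (eqb x y) (eqb y (f x)))
involutive-cycleEq-verdict {f} inv x y with x ≟ y
... | yes refl rewrite eqb-refl x = inj₁ ((0 , inj₁ refl) , refl)
... | no x≢y rewrite eqb-≢ x y x≢y with y ≟ f x
...   | yes refl rewrite eqb-refl (f x) = inj₁ ((1 , inj₁ refl) , refl)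
...   | no y≢fx rewrite eqb-≢ y (f x) y≢fx =
          inj₂ ((λ x≡y → [ (λ y≡x → x≢y (sym y≡x)) , y≢fx ] (cycleEq-involutive inv x≡y)) , refl)

decidesRel : ∀ (D : Prog 2) {R : ℕ → ℕ → Set} → (∀ x y → Verdict (R x y) (fun D (x ∷ y ∷ []))) → DecidesRel (code D) R
decidesRel D verdict x y = fun D (x ∷ y ∷ []) , sem D (x ∷ y ∷ []) , verdict x y

id-In𝒢 : In𝒢 id
id-In𝒢 = involutive⇒bijective (λ _ → refl) , proj fz , λ x → ev-proj fz

id-InPerm : InPerm id
id-InPerm = id-In𝒢 , code D , decidesRel D (involutive-cycleEq-verdict (λ _ → refl))
  where
  D : Prog 2
  D = OR (EQ π₀ π₁) (EQ π₁ π₀)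

∼id⇒≗id : ∀ {f} → f ∼ id → ∀ x → f x ≡ x
∼id⇒≗id (h , ((h-injective , _) , _) , hf≡h) x = h-injective (hf≡h x)

≗id⇒∼id : ∀ {f} → (∀ x → f x ≡ x) → f ∼ id
≗id⇒∼id f≗id = id , id-In𝒢 , f≗id

NUMERALCODE : ∀ {m} → ℕ → Prog m → Prog m
NUMERALCODE n = app₁ (withFun numeralCodeP (λ { (k ∷ []) → ⌜ numeral {n} k ⌝ }) (λ { (k ∷ []) → computes k }))
  where
  numeralCodeP : Prog 1
  numeralCodeP = primRec (const ⌜ zeroᶜ {n} ⌝)
                         (PAIR (const 3) (PAIR (const 1) (PAIR (const ⌜ succᶜ ⌝) (SUCC (PAIR π₀ (const 0))))))
  computes : ∀ k → fun numeralCodeP (k ∷ []) ≡ ⌜ numeral {n} k ⌝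
  computes zero    = refl
  -- cong's implicit arguments are given, since inferring them makes Agda unfold pair
  computes (suc k) = cong (λ c → pair 3 (pair 1 (pair ⌜ succᶜ ⌝ (suc (pair c 0)))))
                          {x = fun numeralCodeP (k ∷ [])} {y = ⌜ numeral {n} k ⌝} (computes k)

instantiate₁ : Prog 3 → ℕ → Prog 1
instantiate₁ E q = compose E (const ⌜ code E ⌝ ∷ const q ∷ π₀ ∷ [])

instantiate₂ : ℕ → Prog 4 → Prog 2
instantiate₂ p D = compose D (const p ∷ const ⌜ code D ⌝ ∷ π₀ ∷ π₁ ∷ [])

-- the codes of instantiate₁ E q and instantiate₂ p D as functions of ⌜ code E ⌝ and q, resp. p and
-- ⌜ code D ⌝; the encodings are spelled out so that code-instantiate₁ and code-instantiate₂ hold by refl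
code₁ : ℕ → ℕ → ℕ
code₁ p q = pair 3 (pair 3 (pair p (suc (pair ⌜ numeral {1} p ⌝ (suc (pair ⌜ numeral {1} q ⌝
              (suc (pair ⌜ proj {1} fz ⌝ 0))))))))

code₂ : ℕ → ℕ → ℕ
code₂ p q = pair 3 (pair 4 (pair q (suc (pair ⌜ numeral {2} p ⌝ (suc (pair ⌜ numeral {2} q ⌝
              (suc (pair ⌜ proj {2} fz ⌝ (suc (pair ⌜ proj {2} (fs fz) ⌝ 0))))))))))

code-instantiate₁ : ∀ E q → ⌜ code (instantiate₁ E q) ⌝ ≡ code₁ ⌜ code E ⌝ q
code-instantiate₁ E q = refl

code-instantiate₂ : ∀ p D → ⌜ code (instantiate₂ p D) ⌝ ≡ code₂ p ⌜ code D ⌝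
code-instantiate₂ p D = refl

CODE₁ : ∀ {m} → Prog m → Prog m → Prog m
CODE₁ p q = PAIR (const 3) (PAIR (const 3) (PAIR p (SUCC (PAIR (NUMERALCODE 1 p) (SUCC (PAIR (NUMERALCODE 1 q)
              (SUCC (PAIR (const ⌜ proj {1} fz ⌝) (const 0)))))))))

CODE₂ : ∀ {m} → Prog m → Prog m → Prog m
CODE₂ p q = PAIR (const 3) (PAIR (const 4) (PAIR q (SUCC (PAIR (NUMERALCODE 2 p) (SUCC (PAIR (NUMERALCODE 2 q)
              (SUCC (PAIR (const ⌜ proj {2} fz ⌝) (SUCC (PAIR (const ⌜ proj {2} (fs fz) ⌝) (const 0)))))))))))

instantiate₁-computes : ∀ E q {f} → (∀ x → fun E (⌜ code E ⌝ ∷ q ∷ x ∷ []) ≡ f x) → Computes (code (instantiate₁ E q)) f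
instantiate₁-computes E q E≗f x = subst (Eval (code (instantiate₁ E q)) (x ∷ [])) (E≗f x) (sem (instantiate₁ E q) (x ∷ []))

instantiate₂-decides : ∀ p D {R} → (∀ x y → Verdict (R x y) (fun D (p ∷ ⌜ code D ⌝ ∷ x ∷ y ∷ []))) →
                       DecidesRel (code (instantiate₂ p D)) R
instantiate₂-decides p D = decidesRel (instantiate₂ p D)

accepts : ∀ {n} → Code n → Vec ℕ n → ℕ → ℕ
accepts c xs t = eqb (run t c xs) 2

accepts-somewhen : ∀ {n} {c : Code n} {xs} → Eval c xs 1 → Σ ℕ λ t → accepts c xs t ≡ 1
accepts-somewhen ev with eventually-at (run-complete ev)
... | t , run≡2 = t , cong (λ r → eqb r 2) run≡2

never-accepts : ∀ {n} {c : Code n} {xs} → Eval c xs 0 → ∀ t → accepts c xs t ≡ 0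
never-accepts {c = c} {xs} ev t =
  eqb-≢ (run t c xs) 2 λ run≡2 → 0≢1 (Eval-deterministic ev (run-sound t c xs 1 run≡2))
  where
  0≢1 : 0 ≢ 1
  0≢1 ()

answer-wrong : ∀ {n} {c : Code n} {xs b} → Eval c xs b → ¬ Verdict (swapWhen (accepts c xs) ∼ id) b
answer-wrong {c = c} {xs} ev (inj₁ (f∼id , refl)) with accepts-somewhen ev
... | t , accepted = swapWhen-moves (accepts c xs) t accepted (∼id⇒≗id f∼id (t + t))
answer-wrong {c = c} {xs} ev (inj₂ (f≁id , refl)) =
  f≁id (≗id⇒∼id (swapWhen-id (accepts c xs) (never-accepts ev)))

module Diagonal (a : Code 2) where

  input : ℕ → ℕ → Vec ℕ 2
  input p q = code₁ p q ∷ code₂ p q ∷ []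

  -- E and D are opaque so that the closed, astronomically large numbers ⌜ code E ⌝ and ⌜ code D ⌝
  -- are never unfolded; E-fun and D-fun export their behaviour.
  opaque
    E : Prog 3
    E = IFZ (EQ (compose (RUN a) (HALF π₂ ∷ CODE₁ π₀ π₁ ∷ CODE₂ π₀ π₁ ∷ [])) (const 2)) π₂ (XOR1 π₂)

    E-fun : ∀ p q x → fun E (p ∷ q ∷ x ∷ []) ≡ swapWhen (accepts a (input p q)) x
    E-fun p q x = refl

    D : Prog 4
    D = OR (EQ π₂ π₃) (EQ π₃ (compose E (π₀ ∷ π₁ ∷ π₂ ∷ [])))

    D-fun : ∀ p q x y → fun D (p ∷ q ∷ x ∷ y ∷ []) ≡ orb (eqb x y) (eqb y (swapWhen (accepts a (input p q)) x))
    D-fun p q x y = refl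

  accepted : ℕ → ℕ
  accepted = accepts a (input ⌜ code E ⌝ ⌜ code D ⌝)

  f : ℕ → ℕ
  f = swapWhen accepted

  e : Code 1
  e = code (instantiate₁ E ⌜ code D ⌝)

  d : Code 2
  d = code (instantiate₂ ⌜ code E ⌝ D)

  e-computes : Computes e f
  e-computes = instantiate₁-computes E ⌜ code D ⌝ (E-fun ⌜ code E ⌝ ⌜ code D ⌝)

  d-decides : DecidesRel d (CycleEq f)
  d-decides = instantiate₂-decides ⌜ code E ⌝ D λ x y →
    subst (Verdict (CycleEq f x y)) (sym (D-fun ⌜ code E ⌝ ⌜ code D ⌝ x y))
          (involutive-cycleEq-verdict (swapWhen-involutive accepted) x y)

  ¬solvesConj : ¬ SolvesConj id a
  ¬solvesConj solves =
    let b , ev , verdict = solves f e d (involutive⇒bijective (swapWhen-involutive accepted)) e-computes d-decides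
    in answer-wrong (subst₂ (λ u v → Eval a (u ∷ v ∷ []) b)
                            (code-instantiate₁ E ⌜ code D ⌝) (code-instantiate₂ ⌜ code E ⌝ D) ev)
                    verdict

theorem4p8 : Σ (ℕ → ℕ) λ g → InPerm g × ¬ (Σ (Code 2) λ a → SolvesConj g a)
theorem4p8 = id , id-InPerm , λ (a , solves) → Diagonal.¬solvesConj a solves
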